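{- Let $S=\{C_1,\dots,C_n\}$ be a finite set of first-order clauses and let $\phi_1,\phi_2,\dots,\phi_t$ be a deduction sequence of contradiction separation based on standard extension from $S$ to $\phi_t$. If $\phi_t=\emptyset$, then $S$ is unsatisfiable.
   Context: First-order logic. A literal is an atom or its negation; $A$ and $\neg A$ (same atom) are complementary. A clause is a finite set of literals (disjunction) with its variables implicitly universally quantified; $\emptyset$ is the empty clause; $S$ is unsatisfiable if the conjunction of the universal closures of its clauses has no model. For a substitution $\theta$, $D^\theta$ is the clause obtained by applying $\theta$ to each literal of $D$ and merging identical literals. Contradiction separation based on standard extension: let $m\ge2$, let $D_1,\dots,D_m$ be clauses (repetitions allowed, variables renamed so that no two share variables), $\theta_1,\dots,\theta_m$ substitutions, $L_1,\dots,L_{m-1}$ literals, and sub-clauses $D_i^{\theta_i- }\subseteq D_i^{\theta_i}$ with $D_1^{\theta_1- }=\{L_1\}$, $D_i^{\theta_i- }=\{L_i,\neg L_{i-1}\}\cup E^i$ for $2\le i\le m-1$, $D_m^{\theta_m- }=\{\neg L_{m-1}\}\cup E^m$, where $E^2=\emptyset$ and $E^j\subseteq\{\neg L_1,\dots,\neg L_{j-2}\}$ for $3\le j\le m$. Then $R_s(D_1^{\theta_1},\dots,D_m^{\theta_m})=\bigcup_{i=1}^m(D_i^{\theta_i}\setminus D_i^{\theta_i- })$ is a contradiction separation clause based on standard extension. A deduction sequence of contradiction separation based on standard extension from $S$ to $\phi_t$ is a sequence of clauses $\phi_1,\dots,\phi_t$ where each $\phi_i$ either lies in $S$ or there are indices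 $r_1,\dots,r_{k_i}<i$ and substitutions such that $\phi_i$ is a contradiction separation clause based on standard extension of the corresponding instances of $\phi_{r_1},\dots,\phi_{r_{k_i}}$. -}

module Defs where

open import Data.Nat using (ℕ; _≤_; _<_; _∸_)
open import Data.Sum using (_⊎_)
open import Data.Bool using (Bool; true; false)
open import Data.List using (List; []; _∷_; [_]; map; _++_)
open import Data.List.Membership.Propositional using (_∈_; _∉_)
open import Data.List.Relation.Binary.Subset.Propositional using (_⊆_)
open import Data.Vec using (Vec; []; _∷_)
open import Data.Product using (Σ; ∃; _×_; _,_)
open import Data.Empty using (⊥)
open import Relation.Nullary using (¬_)
open import Relation.Binary.PropositionalEquality using (_≡_; _≢_)
open import Function using (_∘_)
open import Function.Definitions using (Injective)

record Signature : Set₁ where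
  field
    Fun       : Set
    funArity  : Fun → ℕ
    Pred      : Set
    predArity : Pred → ℕ

module FOL (Sg : Signature) where
  open Signature Sg

  data Term : Set where
    var : ℕ → Term
    fun : (f : Fun) → Vec Term (funArity f) → Term

  data Atom : Set where
    atom : (p : Pred) → Vec Term (predArity p) → Atom

  data Literal : Set where
    pos : Atom → Literal
    neg : Atom → Literal

  ∼_ : Literal → Literal
  ∼ pos a = neg a
  ∼ neg a = pos a

  -- A clause is a finite set of literals, represented by a list;
  -- all set-theoretic notions on clauses are via membership.
  Clause : Set
  Clause = List Literal

  _≈ₛ_ : Clause → Clause → Set
  A ≈ₛ B = ∀ l → (l ∈ A → l ∈ B) × (l ∈ B → l ∈ A)

  Subst : Set
  Subst = ℕ → Term

  mutual
    substT : Subst → Term → Term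
    substT σ (var x)    = σ x
    substT σ (fun f ts) = fun f (substV σ ts)

    substV : ∀ {n} → Subst → Vec Term n → Vec Term n
    substV σ []       = []
    substV σ (t ∷ ts) = substT σ t ∷ substV σ ts

  substA : Subst → Atom → Atom
  substA σ (atom p ts) = atom p (substV σ ts)

  substL : Subst → Literal → Literal
  substL σ (pos a) = pos (substA σ a)
  substL σ (neg a) = neg (substA σ a)

  -- D^θ (identical literals are merged automatically under set semantics)
  _⟦_⟧ : Clause → Subst → Clause
  D ⟦ σ ⟧ = map (substL σ) D

  mutual
    varsT : Term → List ℕ
    varsT (var x)    = x ∷ []
    varsT (fun f ts) = varsV ts

    varsV : ∀ {n} → Vec Term n → List ℕ
    varsV []       = []
    varsV (t ∷ ts) = varsT t ++ varsV ts

  varsL : Literal → List ℕ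
  varsL (pos (atom p ts)) = varsV ts
  varsL (neg (atom p ts)) = varsV ts

  OccursIn : ℕ → Clause → Set
  OccursIn x C = Σ Literal λ l → l ∈ C × x ∈ varsL l

  -- Contradiction separation based on standard extension.
  -- Clauses D_1..D_m are given as D : ℕ → Clause (only indices 1..m matter).
  record CSExtension (m : ℕ) (D : ℕ → Clause) (R : Clause) : Set where
    field
      two≤m  : 2 ≤ m
      θ      : ℕ → Subst
      L      : ℕ → Literal
      Dminus : ℕ → Clause
      E      : ℕ → Clause
      Dminus⊆ : ∀ i → 1 ≤ i → i ≤ m → Dminus i ⊆ (D i ⟦ θ i ⟧)
      first  : Dminus 1 ≈ₛ [ L 1 ]
      middle : ∀ i → 2 ≤ i → i ≤ m ∸ 1 → Dminus i ≈ₛ (L i ∷ ∼ L (i ∸ 1) ∷ E i)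
      last   : Dminus m ≈ₛ (∼ L (m ∸ 1) ∷ E m)
      E²     : E 2 ≡ []
      Eʲ     : ∀ j → 3 ≤ j → j ≤ m → ∀ l → l ∈ E j →
                 Σ ℕ λ k → 1 ≤ k × k ≤ j ∸ 2 × l ≡ ∼ L k
      result : ∀ l → (l ∈ R → Σ ℕ λ i → 1 ≤ i × i ≤ m × l ∈ (D i ⟦ θ i ⟧) × l ∉ Dminus i)
                   × (Σ ℕ (λ i → 1 ≤ i × i ≤ m × l ∈ (D i ⟦ θ i ⟧) × l ∉ Dminus i) → l ∈ R)

  -- φ_i (i ≥ 1) is obtained by a contradiction separation step from earlier
  -- clauses φ_{r_1},...,φ_{r_m} (repetitions allowed), each renamed apart by an
  -- injective variable renaming ρ_j so that no two share variables.
  record CSStep (φ : ℕ → Clause) (i : ℕ) : Set where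
    field
      m   : ℕ
      r   : ℕ → ℕ
      r<i : ∀ j → 1 ≤ j → j ≤ m → 1 ≤ r j × r j < i
      ρ   : ℕ → ℕ → ℕ
      ρ-inj : ∀ j → 1 ≤ j → j ≤ m → Injective _≡_ _≡_ (ρ j)
    D : ℕ → Clause
    D j = φ (r j) ⟦ var ∘ ρ j ⟧
    field
      apart : ∀ j k → 1 ≤ j → j ≤ m → 1 ≤ k → k ≤ m → j ≢ k →
                ∀ x → OccursIn x (D j) → ¬ OccursIn x (D k)
      cs  : CSExtension m D (φ i)

  record DeductionSeq (S : List Clause) (t : ℕ) (φ : ℕ → Clause) : Set where
    field
      1≤t  : 1 ≤ t
      step : ∀ i → 1 ≤ i → i ≤ t → (φ i ∈ S) ⊎ CSStep φ i

  record Structure : Set₁ where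
    field
      Dom   : Set
      elem  : Dom
      funI  : (f : Fun) → Vec Dom (funArity f) → Dom
      predI : (p : Pred) → Vec Dom (predArity p) → Bool

  module _ (M : Structure) where
    open Structure M

    mutual
      evalT : (ℕ → Dom) → Term → Dom
      evalT a (var x)    = a x
      evalT a (fun f ts) = funI f (evalV a ts)

      evalV : ∀ {n} → (ℕ → Dom) → Vec Term n → Vec Dom n
      evalV a []       = []
      evalV a (t ∷ ts) = evalT a t ∷ evalV a ts

    TrueL : (ℕ → Dom) → Literal → Set
    TrueL a (pos (atom p ts)) = predI p (evalV a ts) ≡ true
    TrueL a (neg (atom p ts)) = predI p (evalV a ts) ≡ false

    -- M satisfies the universal closure of C
    Sat : Clause → Set
    Sat C = ∀ (a : ℕ → Dom) → Σ Literal λ l → l ∈ C × TrueL a l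

  Unsatisfiable : List Clause → Set₁
  Unsatisfiable S = (M : Structure) → ¬ (∀ C → C ∈ S → Sat M C)

-- Every inference preserves truth under each valuation: if all the
-- instances D_i^θi are true but R is false, the true literal of each D_i^θi
-- must lie in its separated part D_i^θi−. For D_1 this forces L_1, and then,
-- by induction along the chain, L_i for every i < m, because ¬L_{i-1} and the
-- literals of E^i are already known to be false. Finally nothing in
-- D_m^θm− = {¬L_{m-1}} ∪ E^m can be true. Hence every φ_i is valid in any
-- model of S, and the empty clause is valid in none.
module Submission where

open import Defs
open import Data.Nat using (ℕ; zero; suc; _≤_; _<_; _∸_; z≤n; s≤s)
open import Data.Nat.Properties
  using (≤-trans; ≤-refl; ≤-pred; <⇒≤; m≤n⇒m<n∨m≡n; m∸n≤m; ∸-monoˡ-≤; ∸-monoʳ-≤)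
open import Data.Nat.Induction using (<-rec)
open import Data.Bool using (true; false)
import Data.Bool as Bool
open import Data.List using (List; []; _∷_)
open import Data.List.Relation.Unary.Any using (here; there; any?)
open import Data.List.Membership.Propositional using (_∈_; find; lose)
open import Data.List.Membership.Propositional.Properties using (∈-map⁺)
open import Data.Vec using (Vec; []; _∷_)
open import Data.Product using (Σ; _×_; _,_; proj₁; proj₂)
open import Data.Sum using (inj₁; inj₂)
open import Data.Empty using (⊥; ⊥-elim)
open import Relation.Nullary using (¬_; Dec; yes; no)
open import Relation.Nullary.Decidable using (map′; decidable-stable)
open import Relation.Binary.PropositionalEquality using (_≡_; refl; sym; trans; cong; cong₂; subst)

module _ {Sg : Signature} (M : FOL.Structure Sg) where
  open FOL Sg
  open Structure M

  Valuation : Set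
  Valuation = ℕ → Dom

  TrueC : Valuation → Clause → Set
  TrueC a C = Σ Literal λ l → l ∈ C × TrueL M a l

  _∘ₛ_ : Valuation → Subst → Valuation
  (a ∘ₛ σ) x = evalT M a (σ x)

  mutual
    evalT-substT : ∀ a σ t → evalT M a (substT σ t) ≡ evalT M (a ∘ₛ σ) t
    evalT-substT a σ (var x)    = refl
    evalT-substT a σ (fun f ts) = cong (funI f) (evalV-substV a σ ts)

    evalV-substV : ∀ {n} a σ (ts : Vec Term n) →
                   evalV M a (substV σ ts) ≡ evalV M (a ∘ₛ σ) ts
    evalV-substV a σ []       = refl
    evalV-substV a σ (t ∷ ts) = cong₂ _∷_ (evalT-substT a σ t) (evalV-substV a σ ts)

  TrueL-substL : ∀ a σ l → TrueL M (a ∘ₛ σ) l → TrueL M a (substL σ l)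
  TrueL-substL a σ (pos (atom p ts)) h = trans (cong (predI p) (evalV-substV a σ ts)) h
  TrueL-substL a σ (neg (atom p ts)) h = trans (cong (predI p) (evalV-substV a σ ts)) h

  Sat-⟦⟧ : ∀ C σ → Sat M C → Sat M (C ⟦ σ ⟧)
  Sat-⟦⟧ C σ sat a with sat (a ∘ₛ σ)
  ... | l , l∈C , true-l = substL σ l , ∈-map⁺ (substL σ) l∈C , TrueL-substL a σ l true-l

  TrueL? : ∀ a l → Dec (TrueL M a l)
  TrueL? a (pos (atom p ts)) = predI p (evalV M a ts) Bool.≟ true
  TrueL? a (neg (atom p ts)) = predI p (evalV M a ts) Bool.≟ false

  TrueC? : ∀ a C → Dec (TrueC a C)
  TrueC? a C = map′ find (λ (_ , l∈C , true-l) → lose l∈C true-l) (any? (TrueL? a) C)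

  TrueL-∼ : ∀ a l → TrueL M a l → ¬ TrueL M a (∼ l)
  TrueL-∼ a (pos (atom p ts)) t f with trans (sym t) f
  ... | ()
  TrueL-∼ a (neg (atom p ts)) t f with trans (sym t) f
  ... | ()

  ¬Sat-[] : ¬ Sat M []
  ¬Sat-[] sat with sat (λ _ → elem)
  ... | _ , () , _

  module Refutation {m D R} (cs : CSExtension m D R) (a : Valuation)
    (instances-true : ∀ i → 1 ≤ i → i ≤ m → TrueC a (D i ⟦ CSExtension.θ cs i ⟧))
    (R-false : ¬ TrueC a R) where
    open CSExtension cs

    1≤m : 1 ≤ m
    1≤m = ≤-trans (s≤s z≤n) two≤m

    -- Only ¬¬: membership in Dminus i is undecidable without decidable
    -- equality of symbols.
    separated-true : ∀ i → 1 ≤ i → i ≤ m → ¬ ¬ TrueC a (Dminus i)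
    separated-true i 1≤i i≤m ¬true with instances-true i 1≤i i≤m
    ... | l , l∈Dθ , true-l = R-false (l , proj₂ (result l) (i , 1≤i , i≤m , l∈Dθ , l∉) , true-l)
      where
        l∉ : ¬ l ∈ Dminus i
        l∉ l∈ = ¬true (l , l∈ , true-l)

    ChainTrueUpTo : ℕ → Set
    ChainTrueUpTo k = ∀ j → 1 ≤ j → j ≤ k → TrueL M a (L j)

    ChainTrueUpTo-mono : ∀ {k k′} → k ≤ k′ → ChainTrueUpTo k′ → ChainTrueUpTo k
    ChainTrueUpTo-mono k≤k′ chain j 1≤j j≤k = chain j 1≤j (≤-trans j≤k k≤k′)

    ChainTrueUpTo-suc : ∀ {k} → ChainTrueUpTo k → TrueL M a (L (suc k)) → ChainTrueUpTo (suc k)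
    ChainTrueUpTo-suc chain true-L j 1≤j j≤1+k with m≤n⇒m<n∨m≡n j≤1+k
    ... | inj₁ j<1+k = chain j 1≤j (≤-pred j<1+k)
    ... | inj₂ refl  = true-L

    E-false : ∀ k → 2 ≤ k → k ≤ m → ChainTrueUpTo (k ∸ 2) → ∀ l → l ∈ E k → ¬ TrueL M a l
    E-false 1 (s≤s ()) _ _ _ _ _
    E-false 2 _ _ _ l l∈E₂ _ with subst (l ∈_) E² l∈E₂
    ... | ()
    E-false k@(suc (suc (suc _))) _ k≤m chain l l∈E true-l with Eʲ k (s≤s (s≤s (s≤s z≤n))) k≤m l l∈E
    ... | j , 1≤j , j≤k∸2 , refl = TrueL-∼ a (L j) (chain j 1≤j j≤k∸2) true-l

    L-true : ∀ i → 1 ≤ i → i ≤ m ∸ 1 → ChainTrueUpTo (i ∸ 1) → TrueL M a (L i)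
    L-true 1 _ _ _ = decidable-stable (TrueL? a (L 1)) λ ¬L₁ →
      separated-true 1 ≤-refl 1≤m λ (l , l∈ , true-l) → case₁ ¬L₁ l true-l (proj₁ (first l) l∈)
      where
        case₁ : ¬ TrueL M a (L 1) → ∀ l → TrueL M a l → l ∈ L 1 ∷ [] → ⊥
        case₁ ¬L₁ l true-l (here refl) = ¬L₁ true-l
    L-true i@(suc (suc n)) _ i≤m∸1 chain = decidable-stable (TrueL? a (L i)) λ ¬Lᵢ →
      separated-true i (s≤s z≤n) i≤m λ (l , l∈ , true-l) →
        caseᵢ ¬Lᵢ l true-l (proj₁ (middle i (s≤s (s≤s z≤n)) i≤m∸1 l) l∈)
      where
        i≤m : i ≤ m
        i≤m = ≤-trans i≤m∸1 (m∸n≤m m 1)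
        caseᵢ : ¬ TrueL M a (L i) → ∀ l → TrueL M a l → l ∈ L i ∷ ∼ L (suc n) ∷ E i → ⊥
        caseᵢ ¬Lᵢ l true-l (here refl)         = ¬Lᵢ true-l
        caseᵢ ¬Lᵢ l true-l (there (here refl)) = TrueL-∼ a (L (suc n)) (chain (suc n) (s≤s z≤n) ≤-refl) true-l
        caseᵢ ¬Lᵢ l true-l (there (there l∈E)) =
          E-false i (s≤s (s≤s z≤n)) i≤m (ChainTrueUpTo-mono (m∸n≤m (suc n) 1) chain) l l∈E true-l

    chain-true : ∀ k → k ≤ m ∸ 1 → ChainTrueUpTo k
    chain-true zero    _      _ 1≤j j≤0 with ≤-trans 1≤j j≤0
    ... | ()
    chain-true (suc k) 1+k≤m∸1 =
      ChainTrueUpTo-suc chain-k (L-true (suc k) (s≤s z≤n) 1+k≤m∸1 chain-k)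
      where
        chain-k : ChainTrueUpTo k
        chain-k = chain-true k (≤-trans (m∸n≤m (suc k) 1) 1+k≤m∸1)

    contradiction : ⊥
    contradiction = separated-true m 1≤m ≤-refl λ (l , l∈ , true-l) →
      caseₘ l true-l (proj₁ (last l) l∈)
      where
        chain : ChainTrueUpTo (m ∸ 1)
        chain = chain-true (m ∸ 1) ≤-refl
        caseₘ : ∀ l → TrueL M a l → l ∈ ∼ L (m ∸ 1) ∷ E m → ⊥
        caseₘ l true-l (here refl) =
          TrueL-∼ a (L (m ∸ 1)) (chain (m ∸ 1) (∸-monoˡ-≤ 1 two≤m) ≤-refl) true-l
        caseₘ l true-l (there l∈E) =
          E-false m two≤m ≤-refl (ChainTrueUpTo-mono (∸-monoʳ-≤ m (s≤s z≤n)) chain) l l∈E true-l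

  -- Truth of a clause under one valuation is decidable; this replaces the
  -- classical case split on whether R holds.
  CSExtension-sound : ∀ {m D R} → CSExtension m D R → (∀ i → 1 ≤ i → i ≤ m → Sat M (D i)) → Sat M R
  CSExtension-sound {R = R} cs sat a with TrueC? a R
  ... | yes true-R = true-R
  ... | no  R-false = ⊥-elim (Refutation.contradiction cs a instances-true R-false)
    where
      instances-true : ∀ i → 1 ≤ i → i ≤ _ → TrueC a (_ ⟦ CSExtension.θ cs i ⟧)
      instances-true i 1≤i i≤m = Sat-⟦⟧ _ (CSExtension.θ cs i) (sat i 1≤i i≤m) a

  DeductionSeq-sound : ∀ {S t φ} → DeductionSeq S t φ → (∀ C → C ∈ S → Sat M C) →
                       ∀ i → 1 ≤ i → i ≤ t → Sat M (φ i)
  DeductionSeq-sound {_} {t} {φ} ds sat-S = <-rec _ sound-at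
    where
      sound-at : ∀ i → (∀ {j} → j < i → 1 ≤ j → j ≤ t → Sat M (φ j)) → 1 ≤ i → i ≤ t → Sat M (φ i)
      sound-at i ih 1≤i i≤t with DeductionSeq.step ds i 1≤i i≤t
      ... | inj₁ φᵢ∈S = sat-S (φ i) φᵢ∈S
      ... | inj₂ st   = CSExtension-sound cs λ j 1≤j j≤m →
              let 1≤rⱼ , rⱼ<i = r<i j 1≤j j≤m
              in Sat-⟦⟧ (φ (r j)) _ (ih rⱼ<i 1≤rⱼ (≤-trans (<⇒≤ rⱼ<i) i≤t))
        where open CSStep st

theorem5p3 : (Sg : Signature) → let open FOL Sg in
    (S : List Clause) (t : ℕ) (φ : ℕ → Clause) →
    DeductionSeq S t φ → φ t ≡ [] → Unsatisfiable S
theorem5p3 Sg S t φ ds φₜ≡[] M sat-S =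
  ¬Sat-[] M (subst (Sat M) φₜ≡[] (DeductionSeq-sound M ds sat-S t (DeductionSeq.1≤t ds) ≤-refl))
  where open FOL Sg
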